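{- Let $S$ be a nonempty finite set. For a minimal separating family $\mathcal{P}$ of bipartitions of $S$, let $G_S(\mathcal{P})$ denote the simple graph with vertex set $S$ in which two distinct vertices $x,y$ are adjacent if and only if there is exactly one bipartition in $\mathcal{P}$ that cuts $x$ and $y$. Then the mapping $\mathcal{P}\mapsto G_S(\mathcal{P})$ is a bijection from the set of all minimal separating families of maximum size for $S$ (i.e. minimal separating families whose cardinality is largest among all minimal separating families for $S$) onto the set of all spanning trees on $S$ (spanning trees of the complete graph on vertex set $S$).
   Context: A partition of a set $S$ is a collection of pairwise disjoint nonempty subsets (components) whose union is $S$. A bipartition of $S$ is a partition of $S$ with at most two components (so $\{S\}$ is a bipartition). A partition $P$ cuts two elements if they lie in different components of $P$. A family $\mathcal{P}$ of bipartitions of a finite set $S$ is a separating family for $S$ if every two distinct elements of $S$ are cut by some bipartition in $\mathcal{P}$. A separating family is minimal if no proper subfamily of it is a separating family for $S$. -}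

module Defs where

open import Data.Nat using (ℕ; zero; suc; _≤_; _<_; _≡ᵇ_)
open import Data.Bool using (Bool; true; false; not; _∧_; _xor_; if_then_else_)
open import Data.Fin using (Fin; _≟_)
open import Data.Fin.Subset using (Subset; ∁)
open import Data.Vec using (lookup)
open import Data.List using (List; []; _∷_; _++_; [_]; length)
open import Data.List.Relation.Unary.Any using (Any)
open import Data.List.Relation.Unary.AllPairs using (AllPairs)
open import Data.List.Relation.Unary.Linked using (Linked)
open import Data.List.Relation.Unary.Unique.Propositional using (Unique)
open import Data.List.Relation.Binary.Sublist.Propositional using (_⊆_)
open import Data.List.Membership.Propositional using (_∈_)
open import Data.Product using (Σ; _×_; ∃)
open import Data.Sum using (_⊎_)
open import Relation.Nullary using (¬_)
open import Relation.Nullary.Decidable using (⌊_⌋)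
open import Relation.Binary.PropositionalEquality using (_≡_; _≢_)
open import Relation.Binary.Construct.Closure.ReflexiveTransitive using (Star)

-- A bipartition is represented by a subset A ⊆ S; it stands for the
-- partition {A, S ∖ A} with empty parts dropped (so A = ∅ or A = S
-- represents the trivial bipartition {S}).  Every bipartition arises this
-- way, and A, B represent the same bipartition iff A ≡ B or A ≡ ∁ B.

Bipartition : ℕ → Set
Bipartition m = Subset m

_≈B_ : ∀ {m} → Bipartition m → Bipartition m → Set
A ≈B B = A ≡ B ⊎ A ≡ ∁ B

cutsᵇ : ∀ {m} → Bipartition m → Fin m → Fin m → Bool
cutsᵇ A x y = lookup A x xor lookup A y

Cuts : ∀ {m} → Bipartition m → Fin m → Fin m → Set
Cuts A x y = cutsᵇ A x y ≡ true

-- Families of bipartitions: finite sets of bipartitions, represented by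
-- duplicate-free lists (no two entries represent the same bipartition).

IsFamily : ∀ {m} → List (Bipartition m) → Set
IsFamily P = AllPairs (λ A B → ¬ (A ≈B B)) P

Separating : ∀ {m} → List (Bipartition m) → Set
Separating {m} P = (x y : Fin m) → x ≢ y → Any (λ A → Cuts A x y) P

-- proper subfamilies of a family are exactly the sublists of
-- strictly smaller length
MinimalSeparating : ∀ {m} → List (Bipartition m) → Set
MinimalSeparating P =
  IsFamily P × Separating P ×
  (∀ Q → Q ⊆ P → length Q < length P → ¬ Separating Q)

MaxMinimalSeparating : ∀ {m} → List (Bipartition m) → Set
MaxMinimalSeparating {m} P =
  MinimalSeparating P ×
  (∀ (Q : List (Bipartition m)) → MinimalSeparating Q → length Q ≤ length P)

SameFamily : ∀ {m} → List (Bipartition m) → List (Bipartition m) → Set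
SameFamily P Q =
  (∀ {A} → A ∈ P → Any (A ≈B_) Q) × (∀ {B} → B ∈ Q → Any (B ≈B_) P)

Graph : ℕ → Set
Graph m = Fin m → Fin m → Bool

Adj : ∀ {m} → Graph m → Fin m → Fin m → Set
Adj G x y = G x y ≡ true

IsSimpleGraph : ∀ {m} → Graph m → Set
IsSimpleGraph {m} G = (∀ (x y : Fin m) → G x y ≡ G y x) × (∀ (x : Fin m) → G x x ≡ false)

Connected : ∀ {m} → Graph m → Set
Connected {m} G = (x y : Fin m) → Star (Adj G) x y

Cycle : ∀ {m} → Graph m → Set
Cycle {m} G = Σ (Fin m) λ v → Σ (List (Fin m)) λ ws →
  2 ≤ length ws × Unique (v ∷ ws) × Linked (Adj G) (v ∷ ws ++ [ v ])

Acyclic : ∀ {m} → Graph m → Set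
Acyclic G = ¬ Cycle G

IsSpanningTree : ∀ {m} → Graph m → Set
IsSpanningTree G = IsSimpleGraph G × Connected G × Acyclic G

SameGraph : ∀ {m} → Graph m → Graph m → Set
SameGraph {m} G H = (x y : Fin m) → G x y ≡ H x y

countCuts : ∀ {m} → List (Bipartition m) → Fin m → Fin m → ℕ
countCuts [] x y = 0
countCuts (A ∷ P) x y =
  if cutsᵇ A x y then suc (countCuts P x y) else countCuts P x y

GS : ∀ {m} → List (Bipartition m) → Graph m
GS P x y = not ⌊ x ≟ y ⌋ ∧ (countCuts P x y ≡ᵇ 1)

-- The common refinement of bipartitions B₁, …, B_k of S = Fin (suc n) gains a block whenever Bᵢ cuts a
-- pair that Bᵢ₊₁, …, B_k leave together, so such lists (chains) have at most n members. Every member of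
-- a minimal separating family P is the only one cutting some pair (a private pair); hence P is a chain,
-- |P| ≤ n, and the singletons {v}, v ≠ 0, show that n is the maximum. When |P| = n, a member B with two
-- different private pairs would let two singletons extend P ∖ {B} to a chain of length n + 1, and the
-- vertices reachable from x in G_S(P), appended to P as one more bipartition, would also give such a
-- chain unless they are all of S. So the private pairs are exactly the edges of G_S(P), which is
-- connected; going round a cycle, the owner of one edge would have to cut a second one, so it is a tree.
-- Families with the same graph have members cutting the same edges, hence agreeing up to complement.
-- Conversely, for a spanning tree rooted at 0, deleting the edge from each v ≠ 0 towards the root and
-- taking the component of v gives a family whose private pairs are exactly the tree edges.

module Submission where

open import Defs
open import Level using (_⊔_)
open import Function using (id; _∘_; const; Equivalence; mk⇔)
open import Algebra.Bundles using (CommutativeRing)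
open import Data.Empty using (⊥-elim)
open import Data.Sum using (_⊎_; inj₁; inj₂; [_,_]′)
open import Data.Product using (Σ; _×_; _,_; ∃; ∃₂; proj₁; proj₂)
open import Data.Bool using (Bool; true; false; not; _∧_; _xor_)
open import Data.Bool.Properties
  using (⇔→≡; T-≡; xor-same; xor-comm; xor-annihilates-not; xor-∧-commutativeRing)
  renaming (_≟_ to _≟ᵇ_)
open import Algebra.Properties.CommutativeSemigroup
  (CommutativeRing.+-commutativeSemigroup xor-∧-commutativeRing) using (interchange)
open import Data.Nat using (ℕ; zero; suc; _+_; _≤_; _<_; z≤n; s≤s; _≟_)
open import Data.Nat.Properties
  using (≡ᵇ⇒≡; suc-injective; n≤1+n; ≤-refl; ≤-reflexive; ≤-trans; ≤-antisym; ≤-pred; ≤-<-trans; <-≤-trans;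
         <-irrefl; <-asym; ≮⇒≥; 1+n≰n; m+1+n≰m; m≤n⇒m<n∨m≡n)
open import Data.Fin using (Fin; zero; suc) renaming (_≟_ to _≟ᶠ_; _<_ to _<ᶠ_)
open import Data.Fin.Properties
  using (any?; all?; ¬∀⟶∃¬) renaming (suc-injective to sucᶠ-injective; _<?_ to _<ᶠ?_; <-cmp to <ᶠ-cmp)
open import Data.Fin.Induction using () renaming (<-wellFounded to <ᶠ-wellFounded)
open import Data.Fin.Subset using (Subset; ∁; ⁅_⁆; ∣_∣; _⊂_) renaming (_∈_ to _∈ₛ_; _∉_ to _∉ₛ_; _⊆_ to _⊆ₛ_)
open import Data.Fin.Subset.Properties
  using (_⊆?_; x∈⁅x⁆; x∈⁅y⁆⇒x≡y; x≢y⇒x∉⁅y⁆; ∣p∣≤n; p⊂q⇒∣p∣<∣q∣; x∈p⇒∣p-x∣<∣p∣) renaming (_∈?_ to _∈ₛ?_)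
open import Data.Vec using (Vec; lookup) renaming (tabulate to tabulateᵛ)
open import Data.Vec.Properties
  using (lookup-map; lookup∘tabulate; tabulate∘lookup; tabulate-cong; lookup⇒[]=; []=⇒lookup)
open import Data.List using (List; []; _∷_; _++_; [_]; length; tabulate)
open import Data.List.Properties using (length-++; ++-identityʳ; length-++-sucʳ; length-tabulate)
open import Data.List.Membership.Propositional using (_∈_; _∉_; find; lose)
open import Data.List.Membership.Propositional.Properties using (∈-∃++; ∈-tabulate⁺; ∈-tabulate⁻; ∈-++⁻)
open import Data.List.Relation.Unary.All using ([]; _∷_)
open import Data.List.Relation.Unary.All.Properties using (All¬⇒¬Any; ¬Any⇒All¬)
open import Data.List.Relation.Unary.Any using (Any; here; there) renaming (any? to anyˡ?)
import Data.List.Relation.Unary.Any.Properties as Any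
open import Data.List.Relation.Unary.AllPairs using (AllPairs; []; _∷_)
import Data.List.Relation.Unary.AllPairs as AllPairs
import Data.List.Relation.Unary.AllPairs.Properties as AllPairs
open import Data.List.Relation.Unary.Linked using (Linked; []; [-]; _∷_)
import Data.List.Relation.Unary.Linked as Linked
open import Data.List.Relation.Unary.Unique.Propositional using (Unique)
open import Data.List.Relation.Binary.Sublist.Propositional
  using (_⊆_; []; _∷_; _∷ʳ_; ⊆-refl) renaming (lookup to ⊆-lookup)
open import Data.List.Relation.Binary.Sublist.Propositional.Properties using (++⁺)
open import Induction.WellFounded using (Acc; acc)
open import Relation.Nullary using (¬_; contradiction; Dec; yes; no; does)
open import Relation.Nullary.Decidable using (dec-true; dec-false; ¬?; _×-dec_; _→-dec_; _⊎-dec_)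
open import Relation.Unary using (Pred; Decidable)
open import Relation.Binary.Definitions using (tri<; tri≈; tri>; DecidableEquality)
open import Relation.Binary.PropositionalEquality
  using (_≡_; _≢_; refl; sym; trans; cong; cong₂; subst; module ≡-Reasoning)
open import Relation.Binary.Construct.Closure.ReflexiveTransitive using (Star; ε; _◅_; _◅◅_)

private
  variable
    m n : ℕ

xor≡false⇒≡ : ∀ {a b} → a xor b ≡ false → a ≡ b
xor≡false⇒≡ {false} {false} _ = refl
xor≡false⇒≡ {true}  {true}  _ = refl

xor≡true⇒≡not : ∀ {a b} → a xor b ≡ true → a ≡ not b
xor≡true⇒≡not {false} {true}  _ = refl
xor≡true⇒≡not {true}  {false} _ = refl

xor-transpose : ∀ a b c d → a xor b ≡ c xor d → a xor c ≡ b xor d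
xor-transpose a b c d e = xor≡false⇒≡ (begin
  (a xor c) xor (b xor d) ≡⟨ interchange a c b d ⟩
  (a xor b) xor (c xor d) ≡⟨ cong (_xor (c xor d)) e ⟩
  (c xor d) xor (c xor d) ≡⟨ xor-same (c xor d) ⟩
  false ∎)
  where open ≡-Reasoning

cutsᵇ-irrefl : ∀ (A : Bipartition m) x → cutsᵇ A x x ≡ false
cutsᵇ-irrefl A x = xor-same (lookup A x)

cutsᵇ-sym : ∀ (A : Bipartition m) x y → cutsᵇ A x y ≡ cutsᵇ A y x
cutsᵇ-sym A x y = xor-comm (lookup A x) (lookup A y)

cutsᵇ-triangle : ∀ (A : Bipartition m) x y z → cutsᵇ A x z ≡ cutsᵇ A x y xor cutsᵇ A y z
cutsᵇ-triangle A x y z with lookup A x | lookup A y | lookup A z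
... | false | false | _     = refl
... | false | true  | false = refl
... | false | true  | true  = refl
... | true  | false | false = refl
... | true  | false | true  = refl
... | true  | true  | _     = refl

cutsᵇ-shift : ∀ (A : Bipartition m) {x y} z → cutsᵇ A x y ≡ false → cutsᵇ A x z ≡ cutsᵇ A y z
cutsᵇ-shift A {x} {y} z ¬cxy = trans (cutsᵇ-triangle A x y z) (cong (_xor cutsᵇ A y z) ¬cxy)

cutsᵇ-∁ : ∀ (A : Bipartition m) x y → cutsᵇ (∁ A) x y ≡ cutsᵇ A x y
cutsᵇ-∁ A x y
  rewrite lookup-map x not A | lookup-map y not A = xor-annihilates-not (lookup A x) (lookup A y)

cutsᵇ-resp-≈B : ∀ {A B : Bipartition m} → A ≈B B → ∀ x y → cutsᵇ A x y ≡ cutsᵇ B x y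
cutsᵇ-resp-≈B (inj₁ refl) x y = refl
cutsᵇ-resp-≈B {B = B} (inj₂ refl) x y = cutsᵇ-∁ B x y

Together : List (Bipartition m) → Fin m → Fin m → Set
Together P x y = countCuts P x y ≡ 0

together-refl : ∀ (P : List (Bipartition m)) x → Together P x x
together-refl []      x = refl
together-refl (A ∷ P) x rewrite cutsᵇ-irrefl A x = together-refl P x

countCuts-sym : ∀ (P : List (Bipartition m)) x y → countCuts P x y ≡ countCuts P y x
countCuts-sym []      x y = refl
countCuts-sym (A ∷ P) x y rewrite cutsᵇ-sym A x y | countCuts-sym P x y = refl

together-sym : ∀ (P : List (Bipartition m)) {x y} → Together P x y → Together P y x
together-sym P {x} {y} t = trans (countCuts-sym P y x) t

countCuts-++ : ∀ (P Q : List (Bipartition m)) x y → countCuts (P ++ Q) x y ≡ countCuts P x y + countCuts Q x y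
countCuts-++ []      Q x y = refl
countCuts-++ (A ∷ P) Q x y with cutsᵇ A x y
... | true  = cong suc (countCuts-++ P Q x y)
... | false = countCuts-++ P Q x y

countCuts-head : ∀ (A : Bipartition m) P {x y} → Cuts A x y → countCuts (A ∷ P) x y ≡ suc (countCuts P x y)
countCuts-head A P c rewrite c = refl

together-∷⁻ : ∀ (A : Bipartition m) P {x y} → Together (A ∷ P) x y → cutsᵇ A x y ≡ false × Together P x y
together-∷⁻ A P {x} {y} t with cutsᵇ A x y
... | false = refl , t

countCuts-¬head : ∀ (A : Bipartition m) P {x y} → cutsᵇ A x y ≡ false → countCuts (A ∷ P) x y ≡ countCuts P x y
countCuts-¬head A P ¬c rewrite ¬c = refl

together-trans : ∀ (P : List (Bipartition m)) {x y z} → Together P x y → Together P y z → Together P x z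
together-trans []      _   _   = refl
together-trans (A ∷ P) {x} {y} {z} t₁ t₂
  with together-∷⁻ A P t₁ | together-∷⁻ A P t₂
... | ¬c₁ , t₁′ | ¬c₂ , t₂′ =
  trans (countCuts-¬head A P (trans (cutsᵇ-triangle A x y z) (cong₂ _xor_ ¬c₁ ¬c₂))) (together-trans P t₁′ t₂′)

cuts⇒countCuts>0 : ∀ {P : List (Bipartition m)} {A x y} → A ∈ P → Cuts A x y → 0 < countCuts P x y
cuts⇒countCuts>0 {P = B ∷ P} (here refl) c rewrite c = s≤s z≤n
cuts⇒countCuts>0 {P = B ∷ P} {x = x} {y} (there A∈P) c with cutsᵇ B x y
... | true  = s≤s z≤n
... | false = cuts⇒countCuts>0 A∈P c

together⇒¬cuts : ∀ {P : List (Bipartition m)} {A x y} → Together P x y → A ∈ P → ¬ Cuts A x y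
together⇒¬cuts t A∈P c with () ← subst (0 <_) t (cuts⇒countCuts>0 A∈P c)

countCuts>0⇒cuts : ∀ (P : List (Bipartition m)) {x y} → 0 < countCuts P x y → Any (λ A → Cuts A x y) P
countCuts>0⇒cuts (A ∷ P) {x} {y} pos with cutsᵇ A x y in c
... | true  = here c
... | false = there (countCuts>0⇒cuts P pos)

¬any⇒together : ∀ (P : List (Bipartition m)) {x y} → ¬ Any (λ A → Cuts A x y) P → Together P x y
¬any⇒together []      _  = refl
¬any⇒together (A ∷ P) {x} {y} ¬any with cutsᵇ A x y in c
... | true  = ⊥-elim (¬any (here c))
... | false = ¬any⇒together P (¬any ∘ there)

countCuts-⊆ : ∀ {Q P : List (Bipartition m)} → Q ⊆ P → ∀ x y → countCuts Q x y ≤ countCuts P x y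
countCuts-⊆ [] x y = z≤n
countCuts-⊆ (B ∷ʳ Q⊆P) x y with cutsᵇ B x y
... | true  = ≤-trans (countCuts-⊆ Q⊆P x y) (n≤1+n _)
... | false = countCuts-⊆ Q⊆P x y
countCuts-⊆ (_∷_ {x = B} refl Q⊆P) x y with cutsᵇ B x y
... | true  = s≤s (countCuts-⊆ Q⊆P x y)
... | false = countCuts-⊆ Q⊆P x y

countCuts≡1⇒≢ : ∀ (P : List (Bipartition m)) {x y} → countCuts P x y ≡ 1 → x ≢ y
countCuts≡1⇒≢ P {x} c refl with () ← trans (sym c) (together-refl P x)

countCuts≡1⇒unique : ∀ {P : List (Bipartition m)} {A B x y} → countCuts P x y ≡ 1 →
                     A ∈ P → B ∈ P → Cuts A x y → Cuts B x y → A ≡ B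
countCuts≡1⇒unique {P = C ∷ P} c (here refl) (here refl) _  _  = refl
countCuts≡1⇒unique {P = C ∷ P} c (here refl) (there B∈P) cA cB
  rewrite cA = ⊥-elim (together⇒¬cuts (suc-injective c) B∈P cB)
countCuts≡1⇒unique {P = C ∷ P} c (there A∈P) (here refl) cA cB
  rewrite cB = ⊥-elim (together⇒¬cuts (suc-injective c) A∈P cA)
countCuts≡1⇒unique {P = C ∷ P} {x = x} {y} c (there A∈P) (there B∈P) cA cB with cutsᵇ C x y
... | true  = ⊥-elim (together⇒¬cuts (suc-injective c) A∈P cA)
... | false = countCuts≡1⇒unique c A∈P B∈P cA cB

-- Opaque: letting the type checker unfold these tabulated decision procedures is prohibitively expensive.
opaque
  select : ∀ {p} {P : Pred (Fin m) p} → Decidable P → Subset m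
  select P? = tabulateᵛ (λ x → does (P? x))

  ∈-select⁺ : ∀ {p} {P : Pred (Fin m) p} (P? : Decidable P) {x} → P x → x ∈ₛ select P?
  ∈-select⁺ P? {x} px = lookup⇒[]= x (select P?) (trans (lookup∘tabulate _ x) (dec-true (P? x) px))

  ∈-select⁻ : ∀ {p} {P : Pred (Fin m) p} (P? : Decidable P) {x} → x ∈ₛ select P? → P x
  ∈-select⁻ P? {x} x∈ with P? x | trans (sym (lookup∘tabulate _ x)) ([]=⇒lookup x∈)
  ... | yes px | _ = px

cuts-∈-∉ : ∀ {A : Bipartition m} {x y} → x ∈ₛ A → y ∉ₛ A → Cuts A x y
cuts-∈-∉ {A = A} {x} {y} x∈A y∉A rewrite []=⇒lookup x∈A with lookup A y in e
... | false = refl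
... | true  = ⊥-elim (y∉A (lookup⇒[]= y A e))

¬cuts-⇔ : ∀ {A : Bipartition m} {x y} → (x ∈ₛ A → y ∈ₛ A) → (y ∈ₛ A → x ∈ₛ A) → cutsᵇ A x y ≡ false
¬cuts-⇔ {A = A} {x} {y} x⇒y y⇒x with lookup A x in ex | lookup A y in ey
... | false | false = refl
... | true  | true  = refl
... | true  | false with () ← trans (sym ey) ([]=⇒lookup (x⇒y (lookup⇒[]= x A ex)))
... | false | true  with () ← trans (sym ex) ([]=⇒lookup (y⇒x (lookup⇒[]= y A ey)))

⁅⁆-cuts : ∀ {x y : Fin m} → x ≢ y → Cuts ⁅ x ⁆ x y
⁅⁆-cuts x≢y = cuts-∈-∉ (x∈⁅x⁆ _) (x≢y⇒x∉⁅y⁆ (x≢y ∘ sym))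

⁅⁆-¬cuts : ∀ {t c d : Fin m} → t ≢ c → t ≢ d → cutsᵇ ⁅ t ⁆ c d ≡ false
⁅⁆-¬cuts t≢c t≢d = ¬cuts-⇔ (λ c∈ → ⊥-elim (t≢c (sym (x∈⁅y⁆⇒x≡y _ c∈))))
                            (λ d∈ → ⊥-elim (t≢d (sym (x∈⁅y⁆⇒x≡y _ d∈))))

-- Chains

data Chain {m} : List (Bipartition m) → Set where
  []  : Chain []
  _∷_ : ∀ {B Q} → (∃₂ λ x y → Cuts B x y × Together Q x y) → Chain Q → Chain (B ∷ Q)

-- The blocks of the common refinement of Q are counted through their least elements.
BlockLeast : List (Bipartition m) → Fin m → Set
BlockLeast Q x = ¬ ∃ λ y → y <ᶠ x × Together Q x y

blockLeast? : ∀ (Q : List (Bipartition m)) → Decidable (BlockLeast Q)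
blockLeast? Q x = ¬? (any? λ y → y <ᶠ? x ×-dec countCuts Q x y ≟ 0)

blockLeasts : List (Bipartition m) → Subset m
blockLeasts Q = select (blockLeast? Q)

zero∈blockLeasts : ∀ (Q : List (Bipartition (suc m))) → zero ∈ₛ blockLeasts Q
zero∈blockLeasts Q = ∈-select⁺ (blockLeast? Q) λ ()

blockLeast-of : ∀ (Q : List (Bipartition m)) x → ∃ λ u → u ∈ₛ blockLeasts Q × Together Q u x
blockLeast-of Q x = go x (<ᶠ-wellFounded x)
  where
  go : ∀ x → Acc _<ᶠ_ x → ∃ λ u → u ∈ₛ blockLeasts Q × Together Q u x
  go x (acc rs) with any? (λ y → y <ᶠ? x ×-dec countCuts Q x y ≟ 0)
  ... | no least = x , ∈-select⁺ (blockLeast? Q) least , together-refl Q x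
  ... | yes (y , y<x , t) with u , u∈ , tuy ← go y (rs y<x) =
    u , u∈ , together-trans Q tuy (together-sym Q t)

blockLeast-unique : ∀ (Q : List (Bipartition m)) {u z} → u ∈ₛ blockLeasts Q → z ∈ₛ blockLeasts Q →
                    Together Q u z → u ≡ z
blockLeast-unique Q {u} {z} u∈ z∈ t with <ᶠ-cmp u z
... | tri< u<z _ _ = ⊥-elim (∈-select⁻ (blockLeast? Q) z∈ (u , u<z , together-sym Q t))
... | tri≈ _ u≡z _ = u≡z
... | tri> _ _ z<u = ⊥-elim (∈-select⁻ (blockLeast? Q) u∈ (z , z<u , t))

blockLeasts-∷ : ∀ (B : Bipartition m) Q → blockLeasts Q ⊆ₛ blockLeasts (B ∷ Q)
blockLeasts-∷ B Q u∈ = ∈-select⁺ (blockLeast? (B ∷ Q)) λ (y , y<u , t) →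
  ∈-select⁻ (blockLeast? Q) u∈ (y , y<u , proj₂ (together-∷⁻ B Q t))

blockLeasts-split : ∀ (B : Bipartition m) Q {x y} → Cuts B x y → Together Q x y →
                    blockLeasts Q ⊂ blockLeasts (B ∷ Q)
blockLeasts-split B Q {x} {y} cxy txy = blockLeasts-∷ B Q , new-block
  where
  cut-from : ∀ {u} → Together Q u x → ∃ λ w → Together Q u w × Cuts B u w
  cut-from {u} tux with cutsᵇ B u x in cux
  ... | true  = x , tux , cux
  ... | false = y , together-trans Q tux txy , trans (cutsᵇ-shift B y cux) cxy

  new-block : ∃ λ z → z ∈ₛ blockLeasts (B ∷ Q) × z ∉ₛ blockLeasts Q
  new-block =
    let u , u∈ , tux  = blockLeast-of Q x
        w , tuw , cuw = cut-from tux
        z , z∈ , tzw  = blockLeast-of (B ∷ Q) w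
        ¬czw , tzw′   = together-∷⁻ B Q tzw
        u≡z : z ∈ₛ blockLeasts Q → u ≡ z
        u≡z z∈Q = blockLeast-unique Q u∈ z∈Q (together-trans Q tuw (together-sym Q tzw′))
        czw : z ∈ₛ blockLeasts Q → Cuts B z w
        czw z∈Q = subst (λ v → Cuts B v w) (u≡z z∈Q) cuw
    in z , z∈ , λ z∈Q → contradiction (trans (sym (czw z∈Q)) ¬czw) λ ()

chain-length<blocks : ∀ {m} {Q : List (Bipartition (suc m))} → Chain Q → length Q < ∣ blockLeasts Q ∣
chain-length<blocks {m} {Q = []} [] =
  ≤-<-trans z≤n (x∈p⇒∣p-x∣<∣p∣ {suc m} {zero} {blockLeasts []} (zero∈blockLeasts []))
chain-length<blocks {Q = B ∷ Q} ((_ , _ , cxy , txy) ∷ ch) =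
  <-≤-trans (s≤s (chain-length<blocks ch)) (p⊂q⇒∣p∣<∣q∣ (blockLeasts-split B Q cxy txy))

chain-length : ∀ {Q : List (Bipartition (suc n))} → Chain Q → length Q ≤ n
chain-length {Q = Q} ch = ≤-pred (≤-trans (chain-length<blocks ch) (∣p∣≤n (blockLeasts Q)))

-- Irredundant and minimal separating families

Irredundant : List (Bipartition m) → Set
Irredundant P = ∀ {B} → B ∈ P → ∃₂ λ x y → Cuts B x y × countCuts P x y ≡ 1

irredundant-⊆ : ∀ {Q P : List (Bipartition m)} → Q ⊆ P → Irredundant P → Irredundant Q
irredundant-⊆ {Q = Q} Q⊆P irr B∈Q with x , y , c , c₁ ← irr (⊆-lookup Q⊆P B∈Q) =
  x , y , c , ≤-antisym (subst (countCuts Q x y ≤_) c₁ (countCuts-⊆ Q⊆P x y)) (cuts⇒countCuts>0 B∈Q c)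

chain-++ : ∀ (P : List (Bipartition m)) {E} →
           (∀ {B} → B ∈ P → ∃₂ λ x y → Cuts B x y × countCuts P x y ≡ 1 × Together E x y) →
           Chain E → Chain (P ++ E)
chain-++ []      _    ch = ch
chain-++ (B ∷ P) {E} prv ch = new-cut ∷ chain-++ P prv′ ch
  where
  new-cut : ∃₂ λ x y → Cuts B x y × Together (P ++ E) x y
  new-cut with x , y , c , c₁ , t ← prv (here refl) =
    x , y , c , trans (countCuts-++ P E x y) (cong₂ _+_ (suc-injective (trans (sym (countCuts-head B P c)) c₁)) t)

  prv′ : ∀ {C} → C ∈ P → ∃₂ λ x y → Cuts C x y × countCuts P x y ≡ 1 × Together E x y
  prv′ C∈P with x , y , c , c₁ , t ← prv (there C∈P) =
    x , y , c , ≤-antisym (subst (countCuts P x y ≤_) c₁ (countCuts-⊆ (B ∷ʳ ⊆-refl {x = P}) x y))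
                          (cuts⇒countCuts>0 C∈P c) , t

irredundant⇒chain : ∀ {P : List (Bipartition m)} → Irredundant P → Chain P
irredundant⇒chain {P = P} irr =
  subst Chain (++-identityʳ P) (chain-++ P (λ B∈P → let x , y , c , c₁ = irr B∈P in x , y , c , c₁ , refl) [])

irredundant-length : ∀ {P : List (Bipartition (suc n))} → Irredundant P → length P ≤ n
irredundant-length = chain-length ∘ irredundant⇒chain

⊆-dropMiddle : ∀ {a} {X : Set a} (pre : List X) B suf → pre ++ suf ⊆ pre ++ B ∷ suf
⊆-dropMiddle pre B suf = ++⁺ ⊆-refl (B ∷ʳ ⊆-refl)

countCuts-middle : ∀ {B : Bipartition m} pre suf {x y} →
                   countCuts (pre ++ B ∷ suf) x y ≡ countCuts (B ∷ pre ++ suf) x y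
countCuts-middle []        suf = refl
countCuts-middle {B = B} (A ∷ pre) suf {x} {y} rewrite countCuts-middle {B = B} pre suf {x} {y}
  with cutsᵇ A x y | cutsᵇ B x y
... | true  | true  = refl
... | true  | false = refl
... | false | _     = refl

separates? : ∀ (Q : List (Bipartition m)) x y → Dec (x ≢ y → Any (λ A → Cuts A x y) Q)
separates? Q x y = ¬? (x ≟ᶠ y) →-dec anyˡ? (λ A → cutsᵇ A x y ≟ᵇ true) Q

¬separating⇒together : ∀ (Q : List (Bipartition m)) → ¬ Separating Q → ∃₂ λ x y → x ≢ y × Together Q x y
¬separating⇒together {m} Q ¬sep
  with x , ¬sepₓ ← ¬∀⟶∃¬ m _ (λ x → all? (separates? Q x)) (λ sep → ¬sep λ x y → sep x y)
  with y , ¬sepₓᵧ ← ¬∀⟶∃¬ m _ (separates? Q x) ¬sepₓ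
  with x ≟ᶠ y
... | yes refl = ⊥-elim (¬sepₓᵧ λ x≢x → ⊥-elim (x≢x refl))
... | no x≢y   = x , y , x≢y , ¬any⇒together Q (¬sepₓᵧ ∘ const)

minimal⇒irredundant : ∀ {P : List (Bipartition m)} → MinimalSeparating P → Irredundant P
minimal⇒irredundant (_ , sep , minimal) {B} B∈P
  with pre , suf , refl ← ∈-∃++ B∈P
  with x , y , x≢y , t ← ¬separating⇒together (pre ++ suf)
         (minimal (pre ++ suf) (⊆-dropMiddle pre B suf) (≤-reflexive (sym (length-++-sucʳ pre B suf))))
  with cutsᵇ B x y in c
... | true  = x , y , c , trans (countCuts-middle pre suf) (trans (countCuts-head B (pre ++ suf) c) (cong suc t))
... | false with A , A∈P , cA ← find (sep x y x≢y) =
  ⊥-elim (together⇒¬cuts (trans (countCuts-middle pre suf) (trans (countCuts-¬head B (pre ++ suf) c) t)) A∈P cA)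

∃-dropped : ∀ {a} {X : Set a} {Q P : List X} → AllPairs _≢_ P → Q ⊆ P → length Q < length P →
            ∃ λ B → B ∈ P × B ∉ Q
∃-dropped (B∉P ∷ _) (B ∷ʳ Q⊆P) _ = B , here refl , All¬⇒¬Any B∉P ∘ ⊆-lookup Q⊆P
∃-dropped (B∉P ∷ distinct) (refl ∷ Q⊆P) (s≤s shorter)
  with C , C∈P , C∉Q ← ∃-dropped distinct Q⊆P shorter =
  C , there C∈P , λ { (here refl) → All¬⇒¬Any B∉P C∈P ; (there C∈Q) → C∉Q C∈Q }

irredundant⇒minimal : ∀ {P : List (Bipartition m)} → IsFamily P → Separating P → Irredundant P →
                      MinimalSeparating P
irredundant⇒minimal {P = P} fam sep irr = fam , sep , λ Q Q⊆P shorter sepQ →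
  let B , B∈P , B∉Q = ∃-dropped (AllPairs.map (_∘ inj₁) fam) Q⊆P shorter
      x , y , c , c₁ = irr B∈P
      A , A∈Q , cA = find (sepQ x y (countCuts≡1⇒≢ P c₁))
  in B∉Q (subst (_∈ Q) (countCuts≡1⇒unique c₁ (⊆-lookup Q⊆P A∈Q) B∈P cA c) A∈Q)

-- The maximum size

together-tabulate : ∀ {k} (G : Fin k → Bipartition m) {x y} → (∀ j → cutsᵇ (G j) x y ≡ false) →
                    Together (tabulate G) x y
together-tabulate {k = zero}  G ¬c = refl
together-tabulate {k = suc k} G ¬c =
  trans (countCuts-¬head (G zero) (tabulate (G ∘ suc)) (¬c zero)) (together-tabulate (G ∘ suc) (¬c ∘ suc))

countCuts-tabulate≡1 : ∀ {k} (G : Fin k → Bipartition m) {x y} i → Cuts (G i) x y →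
                       (∀ {j} → i ≢ j → cutsᵇ (G j) x y ≡ false) → countCuts (tabulate G) x y ≡ 1
countCuts-tabulate≡1 G zero    c others =
  trans (countCuts-head (G zero) (tabulate (G ∘ suc)) c) (cong suc (together-tabulate (G ∘ suc) λ j → others λ ()))
countCuts-tabulate≡1 G (suc i) c others =
  trans (countCuts-¬head (G zero) (tabulate (G ∘ suc)) (others λ ()))
        (countCuts-tabulate≡1 (G ∘ suc) i c (λ i≢j → others (i≢j ∘ sucᶠ-injective)))

module IndexedFamily {n} (F : Fin n → Bipartition (suc n)) (a b : Fin n → Fin (suc n))
         (own : ∀ i → Cuts (F i) (a i) (b i))
         (others : ∀ {i j} → i ≢ j → cutsᵇ (F j) (a i) (b i) ≡ false) where

  countCuts-own : ∀ i → countCuts (tabulate F) (a i) (b i) ≡ 1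
  countCuts-own i = countCuts-tabulate≡1 F i (own i) others

  irredundant : Irredundant (tabulate F)
  irredundant B∈ with i , refl ← ∈-tabulate⁻ B∈ = a i , b i , own i , countCuts-own i

  separating : Separating (tabulate F)
  separating x y x≢y with anyˡ? (λ A → cutsᵇ A x y ≟ᵇ true) (tabulate F)
  ... | yes cut = cut
  ... | no ¬cut = ⊥-elim (1+n≰n (subst (_≤ n) (cong suc (length-tabulate F)) (chain-length chain)))
    where
    chain : Chain (⁅ x ⁆ ∷ tabulate F)
    chain = (x , y , ⁅⁆-cuts x≢y , ¬any⇒together _ ¬cut) ∷ irredundant⇒chain irredundant

  maxMinimal : MaxMinimalSeparating (tabulate F)
  maxMinimal =
    irredundant⇒minimal isFamily separating irredundant ,
    λ Q minimal → subst (length Q ≤_) (sym (length-tabulate F)) (irredundant-length (minimal⇒irredundant minimal))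
    where
    isFamily : IsFamily (tabulate F)
    isFamily = AllPairs.tabulate⁺ λ {i} i≢j Fi≈Fj →
      contradiction (trans (sym (own i)) (trans (cutsᵇ-resp-≈B Fi≈Fj (a i) (b i)) (others i≢j))) λ ()

starFamily : ∀ n → List (Bipartition (suc n))
starFamily n = tabulate λ i → ⁅ suc i ⁆

starFamily-maxMinimal : ∀ n → MaxMinimalSeparating (starFamily n)
starFamily-maxMinimal n = IndexedFamily.maxMinimal (λ i → ⁅ suc i ⁆) (const zero) suc
  (λ i → trans (cutsᵇ-sym ⁅ suc i ⁆ zero (suc i)) (⁅⁆-cuts {x = suc i} {zero} λ ()))
  (λ {i} {j} i≢j → ⁅⁆-¬cuts {t = suc j} {c = zero} {d = suc i} (λ ()) (i≢j ∘ sym ∘ sucᶠ-injective))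

maxMinimal⇒n≤length : ∀ {P : List (Bipartition (suc n))} → MaxMinimalSeparating P → n ≤ length P
maxMinimal⇒n≤length {n} {P} (_ , largest) =
  subst (_≤ length P) (length-tabulate _) (largest (starFamily n) (proj₁ (starFamily-maxMinimal n)))

-- Private pairs

SamePair : Fin m → Fin m → Fin m → Fin m → Set
SamePair a b c d = (a ≡ c × b ≡ d) ⊎ (a ≡ d × b ≡ c)

samePair-cuts : ∀ (B : Bipartition m) {a b c d} → SamePair a b c d → Cuts B a b → Cuts B c d
samePair-cuts B (inj₁ (refl , refl)) cut = cut
samePair-cuts B (inj₂ (refl , refl)) cut = trans (cutsᵇ-sym B _ _) cut

samePair? : ∀ (a b c d : Fin m) → Dec (SamePair a b c d)
samePair? a b c d = (a ≟ᶠ c ×-dec b ≟ᶠ d) ⊎-dec (a ≟ᶠ d ×-dec b ≟ᶠ c)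

samePair-swap : ∀ {a b c d : Fin m} → SamePair a b c d → SamePair b a c d
samePair-swap (inj₁ (a≡c , b≡d)) = inj₂ (b≡d , a≡c)
samePair-swap (inj₂ (a≡d , b≡c)) = inj₁ (b≡c , a≡d)

samePair-sym : ∀ {a b c d : Fin m} → SamePair a b c d → SamePair c d a b
samePair-sym (inj₁ (refl , refl)) = inj₁ (refl , refl)
samePair-sym (inj₂ (refl , refl)) = inj₂ (refl , refl)

adj-sym : ∀ {G : Graph m} → IsSimpleGraph G → ∀ {u w} → Adj G u w → Adj G w u
adj-sym (G-sym , _) {u} {w} adj = trans (G-sym w u) adj

samePair-adj : ∀ {G : Graph m} → IsSimpleGraph G → ∀ {a b c d} → SamePair a b c d → Adj G a b → Adj G c d
samePair-adj simple (inj₁ (refl , refl)) adj = adj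
samePair-adj simple (inj₂ (refl , refl)) adj = adj-sym simple adj

samePair-countCuts : ∀ (P : List (Bipartition m)) {a b c d} → SamePair a b c d → countCuts P a b ≡ countCuts P c d
samePair-countCuts P (inj₁ (refl , refl)) = refl
samePair-countCuts P (inj₂ (refl , refl)) = countCuts-sym P _ _

samePair⊎⁅⁆-separates : ∀ {a b c d : Fin m} → a ≢ b →
                        SamePair a b c d ⊎ ∃ λ t → Cuts ⁅ t ⁆ a b × cutsᵇ ⁅ t ⁆ c d ≡ false
samePair⊎⁅⁆-separates {a = a} {b} {c} {d} a≢b with a ≟ᶠ c ⊎-dec a ≟ᶠ d | b ≟ᶠ c ⊎-dec b ≟ᶠ d
... | no a∉ | _      = inj₂ (a , ⁅⁆-cuts a≢b , ⁅⁆-¬cuts (a∉ ∘ inj₁) (a∉ ∘ inj₂))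
... | yes _ | no b∉  =
  inj₂ (b , trans (cutsᵇ-sym ⁅ b ⁆ a b) (⁅⁆-cuts (a≢b ∘ sym)) , ⁅⁆-¬cuts (b∉ ∘ inj₁) (b∉ ∘ inj₂))
... | yes (inj₁ refl) | yes (inj₂ refl) = inj₁ (inj₁ (refl , refl))
... | yes (inj₂ refl) | yes (inj₁ refl) = inj₁ (inj₂ (refl , refl))
... | yes (inj₁ refl) | yes (inj₁ refl) = ⊥-elim (a≢b refl)
... | yes (inj₂ refl) | yes (inj₂ refl) = ⊥-elim (a≢b refl)

together-withoutSoleCutter : ∀ {B : Bipartition m} pre suf {x y} → Cuts B x y →
                             countCuts (pre ++ B ∷ suf) x y ≡ 1 → Together (pre ++ suf) x y
together-withoutSoleCutter {B = B} pre suf cut c₁ =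
  suc-injective (trans (sym (countCuts-head B (pre ++ suf) cut)) (trans (sym (countCuts-middle pre suf)) c₁))

privatePair-unique : ∀ {P : List (Bipartition (suc n))} → Irredundant P → n ≤ length P →
                     ∀ {B a b c d} → B ∈ P → Cuts B a b → countCuts P a b ≡ 1 →
                     Cuts B c d → countCuts P c d ≡ 1 → SamePair a b c d
privatePair-unique {n} irr n≤ {B} {a} {b} {c} {d} B∈P cab ab₁ ccd cd₁
  with pre , suf , refl ← ∈-∃++ B∈P
  with samePair⊎⁅⁆-separates {c = c} {d} (countCuts≡1⇒≢ (pre ++ B ∷ suf) ab₁)
... | inj₁ same = same
... | inj₂ (t , ct , ¬ct) =
  ⊥-elim (1+n≰n (≤-trans (chain-length chain) (subst (n ≤_) (length-++-sucʳ pre B suf) n≤)))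
  where
  chain : Chain (⁅ c ⁆ ∷ ⁅ t ⁆ ∷ pre ++ suf)
  chain = (c , d , ⁅⁆-cuts (countCuts≡1⇒≢ (pre ++ B ∷ suf) cd₁) ,
            trans (countCuts-¬head ⁅ t ⁆ (pre ++ suf) ¬ct) (together-withoutSoleCutter pre suf ccd cd₁))
        ∷ (a , b , ct , together-withoutSoleCutter pre suf cab ab₁)
        ∷ irredundant⇒chain (irredundant-⊆ (⊆-dropMiddle pre B suf) irr)

-- Reachability

⊆∧⊉⇒⊂ : ∀ {p q : Subset m} → p ⊆ₛ q → ¬ q ⊆ₛ p → p ⊂ q
⊆∧⊉⇒⊂ {m} {p} {q} p⊆q q⊈p
  with z , z∉ ← ¬∀⟶∃¬ m (λ z → z ∈ₛ q → z ∈ₛ p) (λ z → z ∈ₛ? q →-dec z ∈ₛ? p) (λ q⊆p → q⊈p (q⊆p _))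
  with z ∈ₛ? q
... | yes z∈q = p⊆q , z , z∈q , z∉ ∘ const
... | no  z∉q = ⊥-elim (z∉ (⊥-elim ∘ z∉q))

inExpansion? : ∀ (G : Graph m) S → Decidable λ z → z ∈ₛ S ⊎ ∃ λ w → w ∈ₛ S × Adj G w z
inExpansion? G S z = z ∈ₛ? S ⊎-dec any? (λ w → w ∈ₛ? S ×-dec G w z ≟ᵇ true)

expand : Graph m → Subset m → Subset m
expand G S = select (inExpansion? G S)

module _ (G : Graph m) {S : Subset m} where

  ∈-expand⁻ : ∀ {z} → z ∈ₛ expand G S → z ∈ₛ S ⊎ ∃ λ w → w ∈ₛ S × Adj G w z
  ∈-expand⁻ = ∈-select⁻ (inExpansion? G S)

  ⊆-expand : S ⊆ₛ expand G S
  ⊆-expand = ∈-select⁺ (inExpansion? G S) ∘ inj₁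

  expand-adj : ∀ {w z} → w ∈ₛ S → Adj G w z → z ∈ₛ expand G S
  expand-adj w∈S adj = ∈-select⁺ (inExpansion? G S) (inj₂ (_ , w∈S , adj))

expand-mono : ∀ (G : Graph m) {S S′} → S ⊆ₛ S′ → expand G S ⊆ₛ expand G S′
expand-mono G S⊆S′ z∈ with ∈-expand⁻ G z∈
... | inj₁ z∈S = ⊆-expand G (S⊆S′ z∈S)
... | inj₂ (w , w∈S , adj) = expand-adj G (S⊆S′ w∈S) adj

within : Graph m → Fin m → ℕ → Subset m
within G x zero    = ⁅ x ⁆
within G x (suc k) = expand G (within G x k)

module _ (G : Graph m) (x : Fin m) where

  x∈within : ∀ k → x ∈ₛ within G x k
  x∈within zero    = x∈⁅x⁆ x
  x∈within (suc k) = ⊆-expand G (x∈within k)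

  within-sound : ∀ k {z} → z ∈ₛ within G x k → Star (Adj G) x z
  within-sound zero    z∈ rewrite x∈⁅y⁆⇒x≡y x z∈ = ε
  within-sound (suc k) z∈ with ∈-expand⁻ G z∈
  ... | inj₁ z∈ₖ = within-sound k z∈ₖ
  ... | inj₂ (w , w∈ₖ , adj) = within-sound k w∈ₖ ◅◅ (adj ◅ ε)

  -- Each round either adds a vertex or changes nothing from then on, so m rounds suffice.
  within-stabilises : ∀ k → within G x (suc k) ⊆ₛ within G x k ⊎ k < ∣ within G x k ∣
  within-stabilises zero = inj₂ (≤-<-trans z≤n (x∈p⇒∣p-x∣<∣p∣ {p = ⁅ x ⁆} (x∈⁅x⁆ x)))
  within-stabilises (suc k) with within-stabilises k
  ... | inj₁ stable = inj₁ (expand-mono G stable)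
  ... | inj₂ k<∣∣ with within G x (suc (suc k)) ⊆? within G x (suc k)
  ...   | yes stable  = inj₁ stable
  ...   | no  growing = inj₂ (≤-trans (s≤s k<∣∣) (p⊂q⇒∣p∣<∣q∣ (⊆∧⊉⇒⊂ (⊆-expand G) (growing ∘ expand-mono G))))

reach : Graph m → Fin m → Subset m
reach {m} G x = within G x m

module _ (G : Graph m) (x : Fin m) where

  x∈reach : x ∈ₛ reach G x
  x∈reach = x∈within G x m

  reach-sound : ∀ {z} → z ∈ₛ reach G x → Star (Adj G) x z
  reach-sound = within-sound G x m

  reach-closed : ∀ {z w} → z ∈ₛ reach G x → Adj G z w → w ∈ₛ reach G x
  reach-closed z∈ adj with within-stabilises G x m
  ... | inj₁ stable = stable (expand-adj G z∈ adj)
  ... | inj₂ m<∣∣   = ⊥-elim (<-irrefl refl (<-≤-trans m<∣∣ (∣p∣≤n (reach G x))))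

  reach-complete : ∀ {z} → Star (Adj G) x z → z ∈ₛ reach G x
  reach-complete = go x∈reach
    where
    go : ∀ {u z} → u ∈ₛ reach G x → Star (Adj G) u z → z ∈ₛ reach G x
    go u∈ ε          = u∈
    go u∈ (adj ◅ p) = go (reach-closed u∈ adj) p

-- G_S(P) is a spanning tree

module _ (P : List (Bipartition m)) where

  Adj-GS⁺ : ∀ {x y} → countCuts P x y ≡ 1 → Adj (GS P) x y
  Adj-GS⁺ {x} {y} c₁ with x ≟ᶠ y
  ... | yes x≡y = ⊥-elim (countCuts≡1⇒≢ P c₁ x≡y)
  ... | no  _   rewrite c₁ = refl

  Adj-GS⁻ : ∀ {x y} → Adj (GS P) x y → countCuts P x y ≡ 1
  Adj-GS⁻ {x} {y} adj with x ≟ᶠ y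
  ... | no _ = ≡ᵇ⇒≡ (countCuts P x y) 1 (Equivalence.from T-≡ adj)

  GS-simple : IsSimpleGraph (GS P)
  GS-simple = GS-sym , GS-irrefl
    where
    GS-sym : ∀ x y → GS P x y ≡ GS P y x
    GS-sym x y with x ≟ᶠ y | y ≟ᶠ x
    ... | yes _   | yes _   = refl
    ... | yes x≡y | no  y≢x = ⊥-elim (y≢x (sym x≡y))
    ... | no  x≢y | yes y≡x = ⊥-elim (x≢y (sym y≡x))
    ... | no  _   | no  _   rewrite countCuts-sym P x y = refl

    GS-irrefl : ∀ x → GS P x x ≡ false
    GS-irrefl x with x ≟ᶠ x
    ... | yes _   = refl
    ... | no  x≢x = ⊥-elim (x≢x refl)

GS-connected : ∀ {P : List (Bipartition (suc n))} → Irredundant P → n ≤ length P → Connected (GS P)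
GS-connected {n} {P} irr n≤ x y with y ∈ₛ? reach (GS P) x
... | yes y∈ = reach-sound (GS P) x y∈
... | no  y∉ = ⊥-elim (m+1+n≰m (length P) (≤-trans (subst (_≤ n) (length-++ P) (chain-length chain)) n≤))
  where
  D : Bipartition (suc n)
  D = reach (GS P) x

  edge-uncut : ∀ {u w} → Adj (GS P) u w → cutsᵇ D u w ≡ false
  edge-uncut adj = ¬cuts-⇔ {A = D} (λ u∈ → reach-closed (GS P) x u∈ adj)
                           (λ w∈ → reach-closed (GS P) x w∈ (adj-sym (GS-simple P) adj))

  chain : Chain (P ++ [ D ])
  chain = chain-++ P (λ B∈P → let u , w , c , c₁ = irr B∈P in
                               u , w , c , c₁ , countCuts-¬head D [] {u} {w} (edge-uncut (Adj-GS⁺ P c₁)))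
                     ((x , y , cuts-∈-∉ {A = D} (x∈reach (GS P) x) y∉ , refl) ∷ [])

data Consecutive {a} {X : Set a} (c d : X) : List X → Set a where
  here  : ∀ {L} → Consecutive c d (c ∷ d ∷ L)
  there : ∀ {x L} → Consecutive c d L → Consecutive c d (x ∷ L)

consecutive-∈ : ∀ {a} {X : Set a} {c d z : X} L → Consecutive c d (L ++ [ z ]) → c ∈ L
consecutive-∈ []          (there ())
consecutive-∈ (x ∷ [])    here               = here refl
consecutive-∈ (x ∷ [])    (there (there ()))
consecutive-∈ (x ∷ y ∷ L) here               = here refl
consecutive-∈ (x ∷ y ∷ L) (there cons)       = there (consecutive-∈ (y ∷ L) cons)

walk-cut : ∀ {r} {R : Fin m → Fin m → Set r} (B : Bipartition m) {u} us {z} →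
           Linked R (u ∷ us ++ [ z ]) → Cuts B u z →
           ∃₂ λ c d → Consecutive c d (u ∷ us ++ [ z ]) × R c d × Cuts B c d
walk-cut B {u} []        {z} (r ∷ _)    cuz = u , z , here , r , cuz
walk-cut B {u} (u′ ∷ us) {z} (r ∷ walk) cuz with cutsᵇ B u u′ in cuu′
... | true  = u , u′ , here , r , cuu′
... | false with c , d , cons , rcd , ccd ← walk-cut B us walk (trans (sym (cutsᵇ-shift B z cuu′)) cuz) =
  c , d , there cons , rcd , ccd

GS-acyclic : ∀ {P : List (Bipartition (suc n))} → Irredundant P → n ≤ length P → Acyclic (GS P)
GS-acyclic _   _  (_ , _ ∷ [] , s≤s () , _)
GS-acyclic {P = P} irr n≤ (v , w₁ ∷ w₂ ∷ ws , _ , (v∉ ∷ w₁∉ ∷ _) , adj ∷ walk)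
  with B , B∈P , cB ← find (countCuts>0⇒cuts P (≤-reflexive (sym (Adj-GS⁻ P adj))))
  with c , d , cons , adj′ , ccd ← walk-cut B (w₂ ∷ ws) walk (trans (cutsᵇ-sym B w₁ v) cB)
  with privatePair-unique irr n≤ B∈P cB (Adj-GS⁻ P adj) ccd (Adj-GS⁻ P adj′)
... | inj₁ (refl , refl) = All¬⇒¬Any v∉ (consecutive-∈ (w₁ ∷ w₂ ∷ ws) cons)
... | inj₂ (refl , refl) with cons
...   | here        = All¬⇒¬Any v∉ (there (here refl))
...   | there cons′ = All¬⇒¬Any w₁∉ (consecutive-∈ (w₂ ∷ ws) cons′)

irredundant⇒GS-spanningTree : ∀ {P : List (Bipartition (suc n))} → Irredundant P → n ≤ length P →
                              IsSpanningTree (GS P)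
irredundant⇒GS-spanningTree {P = P} irr n≤ = GS-simple P , GS-connected irr n≤ , GS-acyclic irr n≤

-- Injectivity

lookup-ext : ∀ {a} {X : Set a} {k} {u v : Vec X k} → (∀ i → lookup u i ≡ lookup v i) → u ≡ v
lookup-ext {u = u} {v} eq = trans (sym (tabulate∘lookup u)) (trans (tabulate-cong eq) (tabulate∘lookup v))

-- Where A and B agree on which edges they cut, lookup A z xor lookup B z is constant along paths.
agreeingCuts⇒≈B : ∀ {G : Graph (suc n)} {A B : Bipartition (suc n)} → Connected G →
                  (∀ {u w} → Adj G u w → cutsᵇ A u w ≡ cutsᵇ B u w) → A ≈B B
agreeingCuts⇒≈B {G = G} {A} {B} conn agree = by-difference (difference zero) refl
  where
  difference : Fin _ → Bool
  difference z = lookup A z xor lookup B z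

  difference-const : ∀ {u w} → Star (Adj G) u w → difference u ≡ difference w
  difference-const ε                = refl
  difference-const (_◅_ {j = v} adj path) =
    trans (xor-transpose (lookup A _) (lookup A v) (lookup B _) (lookup B v) (agree adj)) (difference-const path)

  by-difference : ∀ d → difference zero ≡ d → A ≈B B
  by-difference false d₀ = inj₁ (lookup-ext λ z → xor≡false⇒≡ (trans (sym (difference-const (conn zero z))) d₀))
  by-difference true  d₀ = inj₂ (lookup-ext λ z →
    trans (xor≡true⇒≡not (trans (sym (difference-const (conn zero z))) d₀)) (sym (lookup-map z not B)))

GS-injective : ∀ {P Q : List (Bipartition (suc n))} → Irredundant P → n ≤ length P →
               Irredundant Q → n ≤ length Q → SameGraph (GS P) (GS Q) → ∀ {A} → A ∈ P → Any (A ≈B_) Q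
GS-injective {P = P} {Q} irrP n≤P irrQ n≤Q same {A} A∈P
  with x , y , cA , A-private ← irrP A∈P
  with B-private ← Adj-GS⁻ Q (trans (sym (same x y)) (Adj-GS⁺ P A-private))
  with B , B∈Q , cB ← find (countCuts>0⇒cuts Q (≤-reflexive (sym B-private))) =
  lose B∈Q (agreeingCuts⇒≈B (GS-connected irrP n≤P) agree)
  where
  agree : ∀ {u w} → Adj (GS P) u w → cutsᵇ A u w ≡ cutsᵇ B u w
  agree {u} {w} adj = ⇔→≡ (mk⇔
    (λ cAuw → samePair-cuts B (privatePair-unique irrP n≤P A∈P cA A-private cAuw (Adj-GS⁻ P adj)) cB)
    (λ cBuw → samePair-cuts A (privatePair-unique irrQ n≤Q B∈Q cB B-private cBuw
                                 (Adj-GS⁻ Q (trans (sym (same u w)) adj))) cA))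

-- Surjectivity

least : ∀ {p} {P : Pred ℕ p} → Decidable P → ∀ {k} → P k → ∃ λ j → P j × ∀ {i} → i < j → ¬ P i
least {P = P} P? {k} pk = [ id , (λ none → ⊥-elim (none ≤-refl pk)) ]′ (upTo k)
  where
  upTo : ∀ j → (∃ λ i → P i × ∀ {l} → l < i → ¬ P l) ⊎ (∀ {l} → l ≤ j → ¬ P l)
  upTo zero with P? zero
  ... | yes p₀ = inj₁ (zero , p₀ , λ ())
  ... | no ¬p₀ = inj₂ λ { z≤n → ¬p₀ }
  upTo (suc j) with upTo j
  ... | inj₁ found = inj₁ found
  ... | inj₂ none with P? (suc j)
  ...   | yes p = inj₁ (suc j , p , none ∘ ≤-pred)
  ...   | no ¬p = inj₂ λ l≤1+j → [ none ∘ ≤-pred , (λ { refl → ¬p }) ]′ (m≤n⇒m<n∨m≡n l≤1+j)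

SimplePath : ∀ {a r} {X : Set a} → (X → X → Set r) → X → X → Set (a ⊔ r)
SimplePath R x y = ∃ λ ws → Linked R (x ∷ ws ++ [ y ]) × Unique (x ∷ ws ++ [ y ])

module _ {a r} {X : Set a} {R : X → X → Set r} (_≟ˣ_ : DecidableEquality X) where

  simplePath-suffix : ∀ {x y z} ws → z ∈ x ∷ ws → Linked R (x ∷ ws ++ [ y ]) → Unique (x ∷ ws ++ [ y ]) →
                      SimplePath R z y
  simplePath-suffix ws       (here refl)     path distinct       = ws , path , distinct
  simplePath-suffix (w ∷ ws) (there z∈)      (_ ∷ path) (_ ∷ distinct) = simplePath-suffix ws z∈ path distinct

  -- Loop erasure: cut the walk back to the last visit of its first vertex.
  star⇒simplePath : ∀ {x y} → Star R x y → x ≡ y ⊎ SimplePath R x y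
  star⇒simplePath ε = inj₁ refl
  star⇒simplePath {x} {y} (_◅_ {j = c} r walk) with x ≟ˣ y
  ... | yes x≡y = inj₁ x≡y
  ... | no  x≢y with star⇒simplePath walk
  ...   | inj₁ refl = inj₂ ([] , r ∷ [-] , (x≢y ∷ []) ∷ [] ∷ [])
  ...   | inj₂ (ws , path , distinct) with anyˡ? (x ≟ˣ_) (c ∷ ws)
  ...     | yes x∈ = inj₂ (simplePath-suffix ws x∈ path distinct)
  ...     | no  x∉ = inj₂ (c ∷ ws , r ∷ path , ¬Any⇒All¬ _ x∉path ∷ distinct)
    where
    x∉path : x ∉ c ∷ ws ++ [ y ]
    x∉path x∈ with ∈-++⁻ (c ∷ ws) x∈
    ... | inj₁ x∈cws     = x∉ x∈cws
    ... | inj₂ (here x≡y) = x≢y x≡y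

linked-∷ʳ : ∀ {a r} {X : Set a} {R : X → X → Set r} L {x y : X} →
            Linked R (L ++ [ x ]) → R x y → Linked R ((L ++ [ x ]) ++ [ y ])
linked-∷ʳ []          [-]         r = r ∷ [-]
linked-∷ʳ (_ ∷ [])    (r′ ∷ [-])  r = r′ ∷ r ∷ [-]
linked-∷ʳ (_ ∷ z ∷ L) (r′ ∷ path) r = r′ ∷ linked-∷ʳ (z ∷ L) path r

deleteEdge : Graph m → Fin m → Fin m → Graph m
deleteEdge G a b x y = G x y ∧ not (does (samePair? x y a b))

module _ (G : Graph m) (a b : Fin m) where

  deleteEdge⁺ : ∀ {x y} → Adj G x y → ¬ SamePair x y a b → Adj (deleteEdge G a b) x y
  deleteEdge⁺ {x} {y} adj ¬same rewrite adj | dec-false (samePair? x y a b) ¬same = refl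

  deleteEdge⁻ : ∀ {x y} → Adj (deleteEdge G a b) x y → Adj G x y × ¬ SamePair x y a b
  deleteEdge⁻ {x} {y} = split (G x y) (samePair? x y a b)
    where
    split : ∀ g (same? : Dec (SamePair x y a b)) → g ∧ not (does same?) ≡ true → g ≡ true × ¬ SamePair x y a b
    split true (no ¬same) _ = refl , ¬same

  deleteEdge-sym : IsSimpleGraph G → ∀ {x y} → Adj (deleteEdge G a b) x y → Adj (deleteEdge G a b) y x
  deleteEdge-sym simple adj with adj′ , ¬same ← deleteEdge⁻ adj =
    deleteEdge⁺ (adj-sym simple adj′) (¬same ∘ samePair-swap)

-- A path back from b to a avoiding the edge would close a cycle through it.
acyclic⇒bridge : ∀ {G : Graph m} → IsSimpleGraph G → Acyclic G → ∀ {a b} → Adj G a b →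
                 ¬ Star (Adj (deleteEdge G a b)) b a
acyclic⇒bridge {G = G} (_ , irrefl) acyclic {a} {b} adj walk with star⇒simplePath _≟ᶠ_ walk
... | inj₁ refl = contradiction (trans (sym adj) (irrefl a)) λ ()
... | inj₂ ([] , adj′ ∷ _ , _) = proj₂ (deleteEdge⁻ G a b adj′) (inj₂ (refl , refl))
... | inj₂ (w ∷ ws , path , distinct) =
  acyclic (b , w ∷ ws ++ [ a ] , s≤s (subst (1 ≤_) (sym (length-++-sucʳ ws a [])) (s≤s z≤n)) , distinct ,
           linked-∷ʳ (b ∷ w ∷ ws) (Linked.map (proj₁ ∘ deleteEdge⁻ G a b) path) adj)

-- Root the tree at zero; vertex suc i is joined to its parent by the i-th edge, and the i-th
-- bipartition is the component of suc i once that edge is deleted.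
module TreeFamily {n} (T : Graph (suc n)) (tree : IsSpanningTree T) where

  simple : IsSimpleGraph T
  simple = proj₁ tree

  acyclic : Acyclic T
  acyclic = proj₂ (proj₂ tree)

  level-spec : ∀ v → ∃ λ k → v ∈ₛ within T zero k × ∀ {i} → i < k → v ∉ₛ within T zero i
  level-spec v = least (λ k → v ∈ₛ? within T zero k) {suc n} (reach-complete T zero (proj₁ (proj₂ tree) zero v))

  level : Fin (suc n) → ℕ
  level v = proj₁ (level-spec v)

  level-≤ : ∀ {v k} → v ∈ₛ within T zero k → level v ≤ k
  level-≤ {v} v∈ = ≮⇒≥ λ k<level → proj₂ (proj₂ (level-spec v)) k<level v∈

  lower-neighbour : ∀ {v k} → v ≢ zero → v ∈ₛ within T zero k → (∀ {i} → i < k → v ∉ₛ within T zero i) →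
                    ∃ λ w → Adj T w v × level w < k
  lower-neighbour {k = zero}  v≢0 v∈ _ = ⊥-elim (v≢0 (x∈⁅y⁆⇒x≡y zero v∈))
  lower-neighbour {k = suc k} v≢0 v∈ first with ∈-expand⁻ T v∈
  ... | inj₁ v∈ₖ             = ⊥-elim (first ≤-refl v∈ₖ)
  ... | inj₂ (w , w∈ₖ , adj) = w , adj , s≤s (level-≤ w∈ₖ)

  parent-spec : ∀ i → ∃ λ w → Adj T w (suc i) × level w < level (suc i)
  parent-spec i = let _ , v∈ , first = level-spec (suc i) in lower-neighbour (λ ()) v∈ first

  parent : Fin n → Fin (suc n)
  parent i = proj₁ (parent-spec i)

  parent-adj : ∀ i → Adj T (parent i) (suc i)
  parent-adj i = proj₁ (proj₂ (parent-spec i))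

  parent-level : ∀ i → level (parent i) < level (suc i)
  parent-level i = proj₂ (proj₂ (parent-spec i))

  edges-distinct : ∀ {i j} → i ≢ j → ¬ SamePair (suc i) (parent i) (parent j) (suc j)
  edges-distinct {i} {j} _ (inj₁ (i≡pj , pi≡j)) =
    <-asym (subst (λ u → level u < level (suc i)) pi≡j (parent-level i))
           (subst (λ u → level u < level (suc j)) (sym i≡pj) (parent-level j))
  edges-distinct i≢j (inj₂ (i≡j , _)) = i≢j (sucᶠ-injective i≡j)

  treeWithout : Fin n → Graph (suc n)
  treeWithout i = deleteEdge T (parent i) (suc i)

  component : Fin n → Bipartition (suc n)
  component i = reach (treeWithout i) (suc i)

  component-uncut : ∀ i {x y} → Adj (treeWithout i) x y → cutsᵇ (component i) x y ≡ false
  component-uncut i adj = ¬cuts-⇔ {A = component i} (λ x∈ → reach-closed (treeWithout i) (suc i) x∈ adj)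
    (λ y∈ → reach-closed (treeWithout i) (suc i) y∈ (deleteEdge-sym T (parent i) (suc i) simple adj))

  component-own : ∀ i → Cuts (component i) (suc i) (parent i)
  component-own i = cuts-∈-∉ {A = component i} (x∈reach (treeWithout i) (suc i))
                      (acyclic⇒bridge simple acyclic (parent-adj i) ∘ reach-sound (treeWithout i) (suc i))

  component-others : ∀ {i j} → i ≢ j → cutsᵇ (component j) (suc i) (parent i) ≡ false
  component-others {i} {j} i≢j =
    component-uncut j (deleteEdge⁺ T (parent j) (suc j) (adj-sym simple (parent-adj i)) (edges-distinct i≢j))

  open IndexedFamily component suc parent component-own component-others public

  family : List (Bipartition (suc n))
  family = tabulate component

  GS-family : SameGraph (GS family) T
  GS-family x y = ⇔→≡ (mk⇔ GS⇒T T⇒GS)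
    where
    GS⇒T : Adj (GS family) x y → Adj T x y
    GS⇒T adj =
      let c₁ = Adj-GS⁻ family adj
          j , cj = Any.tabulate⁻ (countCuts>0⇒cuts family (≤-reflexive (sym c₁)))
          n≤ = ≤-reflexive (sym (length-tabulate component))
          same = privatePair-unique irredundant n≤ (∈-tabulate⁺ j) cj c₁ (component-own j) (countCuts-own j)
      in samePair-adj simple (samePair-sym same) (adj-sym simple (parent-adj j))

    T⇒GS : Adj T x y → Adj (GS family) x y
    T⇒GS adj = let j , cj = Any.tabulate⁻ (separating x y x≢y) in by-edge j cj (samePair? x y (parent j) (suc j))
      where
      x≢y : x ≢ y
      x≢y refl = contradiction (trans (sym adj) (proj₂ simple x)) λ ()

      by-edge : ∀ j → Cuts (component j) x y → Dec (SamePair x y (parent j) (suc j)) → Adj (GS family) x y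
      by-edge j _  (yes same) = Adj-GS⁺ family (trans (samePair-countCuts family same)
                                                  (trans (countCuts-sym family (parent j) (suc j)) (countCuts-own j)))
      by-edge j cj (no ¬same) =
        contradiction (trans (sym cj) (component-uncut j (deleteEdge⁺ T (parent j) (suc j) adj ¬same))) λ ()

maxMinimal⇒GS-spanningTree : ∀ (P : List (Bipartition (suc n))) → MaxMinimalSeparating P → IsSpanningTree (GS P)
maxMinimal⇒GS-spanningTree P max =
  irredundant⇒GS-spanningTree (minimal⇒irredundant (proj₁ max)) (maxMinimal⇒n≤length max)

maxMinimal-GS-injective : ∀ (P Q : List (Bipartition (suc n))) → MaxMinimalSeparating P → MaxMinimalSeparating Q →
                          SameGraph (GS P) (GS Q) → SameFamily P Q
maxMinimal-GS-injective {n} P Q maxP maxQ same =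
  GS-injective irrP n≤P irrQ n≤Q same , GS-injective irrQ n≤Q irrP n≤P (λ x y → sym (same x y))
  where
  irrP : Irredundant P
  irrP = minimal⇒irredundant (proj₁ maxP)
  irrQ : Irredundant Q
  irrQ = minimal⇒irredundant (proj₁ maxQ)
  n≤P : n ≤ length P
  n≤P = maxMinimal⇒n≤length maxP
  n≤Q : n ≤ length Q
  n≤Q = maxMinimal⇒n≤length maxQ

spanningTree⇒GS-preimage : ∀ (T : Graph (suc n)) → IsSpanningTree T →
                           Σ (List (Bipartition (suc n))) λ P → MaxMinimalSeparating P × SameGraph (GS P) T
spanningTree⇒GS-preimage T tree = family , maxMinimal , GS-family
  where open TreeFamily T tree

theorem2p2 : (n : ℕ) →
    ((P : List (Bipartition (suc n))) → MaxMinimalSeparating P → IsSpanningTree (GS P))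
    × ((P Q : List (Bipartition (suc n))) → MaxMinimalSeparating P → MaxMinimalSeparating Q
         → SameGraph (GS P) (GS Q) → SameFamily P Q)
    × ((T : Graph (suc n)) → IsSpanningTree T
         → Σ (List (Bipartition (suc n))) λ P → MaxMinimalSeparating P × SameGraph (GS P) T)
theorem2p2 n = maxMinimal⇒GS-spanningTree , maxMinimal-GS-injective , spanningTree⇒GS-preimage
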